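{- Let $n,k$ be integers with $n>2k$ and $k\ge 2$ even. (a) If $(k-1)\mid n$, then $\beta(P(n,k))\le n+\frac{n}{k-1}$. (b) If $(k-1)\nmid n$, then $\beta(P(n,k))\le n+\left\lfloor\frac{n}{k-1}\right\rfloor+2k$.
   Context: $P(n,k)$ is the generalized Petersen graph with vertices $u_1,\dots,u_n,v_1,\dots,v_n$ and edges $u_iu_{i+1}$, $u_iv_i$, $v_iv_{i+k}$ (subscripts modulo $n$). $\beta(G)$ denotes the size of a minimum vertex cover of $G$. -}

module Defs where

open import Data.Nat using (ℕ; suc; _+_; _≤_; NonZero)
open import Data.Nat.DivMod using (_mod_)
open import Data.Fin using (Fin; toℕ)
open import Data.Fin.Subset using (Subset; _∈_; ∣_∣)
open import Data.Product using (Σ; _×_; _,_)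
open import Data.Sum using (_⊎_)

data PVertex (n : ℕ) : Set where
  u : Fin n → PVertex n
  v : Fin n → PVertex n

_⊕_ : ∀ {n} .{{_ : NonZero n}} → Fin n → ℕ → Fin n
_⊕_ {n} i j = (toℕ i + j) mod n

-- Edge set of P(n,k) (as a list of generators; each edge is given by one orientation):
-- u_i u_{i+1},  u_i v_i,  v_i v_{i+k}.
data PEdge (n k : ℕ) .{{_ : NonZero n}} : PVertex n → PVertex n → Set where
  outer : (i : Fin n) → PEdge n k (u i) (u (i ⊕ 1))
  spoke : (i : Fin n) → PEdge n k (u i) (v i)
  inner : (i : Fin n) → PEdge n k (v i) (v (i ⊕ k))

record VSet (n : ℕ) : Set where
  constructor vset
  field
    outerPart : Subset n
    innerPart : Subset n

open VSet public

_∈V_ : ∀ {n} → PVertex n → VSet n → Set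
u i ∈V S = i ∈ outerPart S
v i ∈V S = i ∈ innerPart S

size : ∀ {n} → VSet n → ℕ
size S = ∣ outerPart S ∣ + ∣ innerPart S ∣

IsVertexCover : (n k : ℕ) .{{_ : NonZero n}} → VSet n → Set
IsVertexCover n k S = ∀ x y → PEdge n k x y → x ∈V S ⊎ y ∈V S

-- β(P(n,k)) ≤ m  ⇔  P(n,k) has a vertex cover of size at most m
-- (β is the minimum vertex-cover size, so this is the literal meaning of β ≤ m).
β≤ : (n k : ℕ) .{{_ : NonZero n}} → ℕ → Set
β≤ n k m = Σ (VSet n) (λ S → IsVertexCover n k S × size S ≤ m)

open import Data.Nat using (_*_; _<_; _∸_; >-nonZero)
open import Data.Nat.Properties using (m<n⇒0<n; m<n⇒0<n∸m)

n-nonZero : ∀ n k → 2 * k < n → NonZero n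
n-nonZero n k h = >-nonZero (m<n⇒0<n h)

k-1-nonZero : ∀ {k} → 2 ≤ k → NonZero (k ∸ 1)
k-1-nonZero h = >-nonZero (m<n⇒0<n∸m h)

module Submission where

-- Put d = k - 1 and cut the indices 0,…,n-1 into c consecutive blocks of
-- length d followed by a tail 0 ≤ c·d ≤ n.  Inside the blocks, an index i with
-- residue s = i mod d contributes u_i when s is even and v_i when s is odd or
-- s = 0; every tail index contributes both u_i and v_i.  Neither residue pattern
-- misses two consecutive residues and both contain residue 0 ("gap-free"), which
-- covers the outer edges u_i u_{i+1} and the inner edges v_i v_{i+k}, because
-- i + k ≡ i + 1 (mod d) as long as the inner edge does not wrap around
-- inconsistently (guaranteed by d ∣ n, or by the blocks ending more than d
-- indices before n).
-- Each block costs d + 1 vertices and each tail index 2, so the cover has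
-- n + c + (n - c·d) vertices (lemma block-cover).  The corollary chooses
-- c = n / d when d ∣ n, and c = ⌊n/d⌋ - 1 otherwise, leaving a tail shorter
-- than 2d.  The construction does not need k to be even.

open import Defs
open import Data.Nat using (ℕ; zero; suc; _+_; _*_; _∸_; _<_; _≤_; _<?_; NonZero; z<s; s<s)
open import Data.Nat.Properties
open import Data.Nat.DivMod
  using (_/_; _%_; m%n<n; m<n⇒m%n≡m; [m+n]%n≡m%n; [m+kn]%n≡m%n; m*n%n≡0; n%n≡0;
         m∣n⇒o%n%m≡o%m; m/n*n≡m; m≡m%n+[m/n]*n; m≥n⇒m/n>0)
open import Data.Nat.Divisibility using (_∣_; _∤_; m%n≡0⇒n∣m)
open import Data.Nat.Tactic.RingSolver using (solve-∀)
open import Algebra.Properties.CommutativeSemigroup +-commutativeSemigroup using (interchange)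
open import Data.Bool using (Bool; true; false; not; _∨_)
open import Data.Fin using (Fin; toℕ)
open import Data.Fin.Properties using (toℕ<n; toℕ-fromℕ<)
open import Data.Fin.Subset using (Subset; _∈_; ∣_∣)
open import Data.Vec using (tabulate)
open import Data.Vec.Properties using (lookup∘tabulate; lookup⇒[]=)
open import Data.Product using (_×_; _,_)
open import Data.Sum using (_⊎_; inj₁; inj₂)
open import Function using (_∘_)
open import Relation.Nullary using (yes; no; contradiction)
open import Relation.Binary.PropositionalEquality

sumBelow : (ℕ → ℕ) → ℕ → ℕ
sumBelow f zero    = 0
sumBelow f (suc n) = f 0 + sumBelow (f ∘ suc) n

sumBelow-cong : ∀ n {f g} → (∀ i → i < n → f i ≡ g i) → sumBelow f n ≡ sumBelow g n
sumBelow-cong zero    f≗g = refl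
sumBelow-cong (suc n) f≗g =
  cong₂ _+_ (f≗g 0 z<s) (sumBelow-cong n (λ i i<n → f≗g (suc i) (s<s i<n)))

sumBelow-+ : ∀ a b f → sumBelow f (a + b) ≡ sumBelow f a + sumBelow (λ j → f (a + j)) b
sumBelow-+ zero    b f = refl
sumBelow-+ (suc a) b f =
  trans (cong (f 0 +_) (sumBelow-+ a b (f ∘ suc))) (sym (+-assoc (f 0) _ _))

sumBelow-pointwise : ∀ n f g → sumBelow (λ i → f i + g i) n ≡ sumBelow f n + sumBelow g n
sumBelow-pointwise zero    f g = refl
sumBelow-pointwise (suc n) f g =
  trans (cong (f 0 + g 0 +_) (sumBelow-pointwise n (f ∘ suc) (g ∘ suc)))
        (interchange (f 0) (g 0) _ _)

sumBelow-const : ∀ n c → sumBelow (λ _ → c) n ≡ n * c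
sumBelow-const zero    c = refl
sumBelow-const (suc n) c = cong (c +_) (sumBelow-const n c)

sumBelow-periodic : ∀ d .{{_ : NonZero d}} c f →
  sumBelow (λ i → f (i % d)) (c * d) ≡ c * sumBelow f d
sumBelow-periodic d zero    f = refl
sumBelow-periodic d (suc c) f = begin
  sumBelow (λ i → f (i % d)) (d + c * d)
    ≡⟨ sumBelow-+ d (c * d) _ ⟩
  sumBelow (λ i → f (i % d)) d + sumBelow (λ j → f ((d + j) % d)) (c * d)
    ≡⟨ cong₂ _+_ (sumBelow-cong d (λ i i<d → cong f (m<n⇒m%n≡m i<d)))
                 (sumBelow-cong (c * d) (λ j _ → cong f (shift j))) ⟩
  sumBelow f d + sumBelow (λ j → f (j % d)) (c * d)
    ≡⟨ cong (sumBelow f d +_) (sumBelow-periodic d c f) ⟩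
  sumBelow f d + c * sumBelow f d ∎
  where
  open ≡-Reasoning
  shift : ∀ j → (d + j) % d ≡ j % d
  shift j = trans (cong (_% d) (+-comm d j)) ([m+n]%n≡m%n j d)

indicator : Bool → ℕ
indicator true  = 1
indicator false = 0

∣tabulate∣ : ∀ n (g : ℕ → Bool) → ∣ tabulate {n = n} (g ∘ toℕ) ∣ ≡ sumBelow (indicator ∘ g) n
∣tabulate∣ zero    g = refl
∣tabulate∣ (suc n) g with g 0
... | true  = cong suc (∣tabulate∣ n (g ∘ suc))
... | false = ∣tabulate∣ n (g ∘ suc)

∈tabulate : ∀ {n} (g : ℕ → Bool) (j : Fin n) → g (toℕ j) ≡ true → j ∈ tabulate (g ∘ toℕ)
∈tabulate g j gj = lookup⇒[]= j _ (trans (lookup∘tabulate (g ∘ toℕ) j) gj)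

isEven : ℕ → Bool
isEven zero    = true
isEven (suc s) = not (isEven s)

isZero : ℕ → Bool
isZero zero    = true
isZero (suc _) = false

-- Residues s for which u_i, resp. v_i, is put into the cover.
outerRes : ℕ → Bool
outerRes = isEven

innerRes : ℕ → Bool
innerRes s = not (isEven s) ∨ isZero s

-- Every residue is used on the outer or on the inner side (covers spokes).
outerRes-or-innerRes : ∀ s → outerRes s ≡ false → innerRes s ≡ true
outerRes-or-innerRes s odd rewrite odd = refl

-- Residue 0 is used on both sides, every other residue on exactly one:
-- the cost of a period of length d is d + 1.
residueWeight : ℕ → ℕ
residueWeight s = indicator (outerRes s) + indicator (innerRes s)

residueWeight-suc : ∀ s → residueWeight (suc s) ≡ 1
residueWeight-suc s with isEven s
... | true  = refl
... | false = refl

period-weight : ∀ d .{{_ : NonZero d}} → sumBelow residueWeight d ≡ suc d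
period-weight (suc d) =
  cong (2 +_) (trans (sumBelow-cong d (λ s _ → residueWeight-suc s))
                     (trans (sumBelow-const d 1) (*-identityʳ d)))

-- A residue pattern is gap-free if it contains 0 and never misses two
-- consecutive residues; one missing endpoint of a "successor" edge then
-- forces the other endpoint into the cover.
record GapFree (R : ℕ → Bool) : Set where
  field
    at-zero   : R 0 ≡ true
    after-gap : ∀ s → R s ≡ false → R (suc s) ≡ true

outerRes-gapFree : GapFree outerRes
outerRes-gapFree = record { at-zero = refl ; after-gap = gap }
  where
  gap : ∀ s → isEven s ≡ false → not (isEven s) ≡ true
  gap s odd rewrite odd = refl

innerRes-gapFree : GapFree innerRes
innerRes-gapFree = record { at-zero = refl ; after-gap = gap }
  where
  gap : ∀ s → innerRes s ≡ false → innerRes (suc s) ≡ true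
  gap s missing with isEven s
  gap s missing | true = refl
  gap s ()      | false

suc-%-shift : ∀ i d .{{_ : NonZero d}} → suc i % d ≡ suc (i % d) % d
suc-%-shift i d = trans (cong (λ z → suc z % d) (m≡m%n+[m/n]*n i d))
                        ([m+kn]%n≡m%n (suc (i % d)) (i / d) d)

suc-residue : ∀ i d .{{_ : NonZero d}} → suc i % d ≡ suc (i % d) ⊎ suc i % d ≡ 0
suc-residue i d with m≤n⇒m<n∨m≡n (m%n<n i d)
... | inj₁ s<d   = inj₁ (trans (suc-%-shift i d) (m<n⇒m%n≡m s<d))
... | inj₂ s+1≡d = inj₂ (trans (suc-%-shift i d) (trans (cong (_% d) s+1≡d) (n%n≡0 d)))

gapFree-next : ∀ {R} → GapFree R → ∀ d .{{_ : NonZero d}} i →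
  R (i % d) ≡ false → R (suc i % d) ≡ true
gapFree-next {R} gf d i missing with suc-residue i d
... | inj₁ incr = subst (λ s → R s ≡ true) (sym incr) (GapFree.after-gap gf _ missing)
... | inj₂ wrap = subst (λ s → R s ≡ true) (sym wrap) (GapFree.at-zero gf)

cost-rearranged : ∀ c d t → c * suc d + t * 2 ≡ c * d + t + c + t
cost-rearranged = solve-∀

module BlockCover (n d c : ℕ) .{{_ : NonZero n}} .{{_ : NonZero d}} where

  blocksEnd : ℕ
  blocksEnd = c * d

  inPattern : (ℕ → Bool) → ℕ → Bool
  inPattern R i with i <? blocksEnd
  ... | yes _ = R (i % d)
  ... | no  _ = true

  inPattern-residue : ∀ R i → R (i % d) ≡ true → inPattern R i ≡ true
  inPattern-residue R i present with i <? blocksEnd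
  ... | yes _ = present
  ... | no  _ = refl

  members : (ℕ → Bool) → Subset n
  members R = tabulate (inPattern R ∘ toℕ)

  cover : VSet n
  cover = vset (members outerRes) (members innerRes)

  selected-or-missing : ∀ R i → inPattern R i ≡ true ⊎ (i < blocksEnd × R (i % d) ≡ false)
  selected-or-missing R i with i <? blocksEnd | R (i % d) in eq
  ... | yes _   | true  = inj₁ eq
  ... | yes i<e | false = inj₂ (i<e , refl)
  ... | no  _   | _     = inj₁ refl

  covers-edge : ∀ R Q (x y : Fin n) →
    (toℕ x < blocksEnd → R (toℕ x % d) ≡ false → Q (toℕ y % d) ≡ true) →
    x ∈ members R ⊎ y ∈ members Q
  covers-edge R Q x y forced with selected-or-missing R (toℕ x)
  ... | inj₁ x∈         = inj₁ (∈tabulate (inPattern R) x x∈)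
  ... | inj₂ (x<e , x∉) =
    inj₂ (∈tabulate (inPattern Q) y (inPattern-residue Q (toℕ y) (forced x<e x∉)))

  toℕ-⊕ : ∀ (i : Fin n) a → toℕ (i ⊕ a) ≡ (toℕ i + a) % n
  toℕ-⊕ i a = toℕ-fromℕ< (m%n<n (toℕ i + a) n)

  toℕ-⊕1 : ∀ (i : Fin n) → toℕ (i ⊕ 1) ≡ suc (toℕ i) % n
  toℕ-⊕1 i = trans (toℕ-⊕ i 1) (cong (_% n) (+-comm (toℕ i) 1))

  cycle-successor : ∀ (i : Fin n) → toℕ (i ⊕ 1) ≡ suc (toℕ i) ⊎ toℕ (i ⊕ 1) ≡ 0
  cycle-successor i with suc-residue (toℕ i) n
  ... | inj₁ incr = inj₁ (trans (toℕ-⊕1 i) (trans incr (cong suc (m<n⇒m%n≡m (toℕ<n i)))))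
  ... | inj₂ wrap = inj₂ (trans (toℕ-⊕1 i) wrap)

  outer-next : ∀ {R} → GapFree R → (i : Fin n) →
    R (toℕ i % d) ≡ false → R (toℕ (i ⊕ 1) % d) ≡ true
  outer-next {R} gf i missing with cycle-successor i
  ... | inj₁ next = subst (λ t → R (t % d) ≡ true) (sym next) (gapFree-next gf d (toℕ i) missing)
  ... | inj₂ first = subst (λ t → R (t % d) ≡ true) (sym first)
                       (subst (λ s → R s ≡ true) (sym (m*n%n≡0 0 d)) (GapFree.at-zero gf))

  k≡1-mod-d : ∀ i → (i + suc d) % d ≡ suc i % d
  k≡1-mod-d i = trans (cong (_% d) (+-suc i d)) ([m+n]%n≡m%n (suc i) d)

  -- Inner edges v_i v_{i+k} with i in a block: since k = d + 1, the residue of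
  -- i + k is that of i + 1, provided the wrap-around mod n respects residues mod d.
  inner-residue : d ∣ n ⊎ blocksEnd + d < n → ∀ i → i < blocksEnd →
    (i + suc d) % n % d ≡ suc i % d
  inner-residue (inj₁ d∣n) i i<e = trans (m∣n⇒o%n%m≡o%m d n (i + suc d) d∣n) (k≡1-mod-d i)
  inner-residue (inj₂ end<n) i i<e = trans (cong (_% d) (m<n⇒m%n≡m i+k<n)) (k≡1-mod-d i)
    where
    i+k<n : i + suc d < n
    i+k<n = ≤-<-trans (≤-trans (≤-reflexive (+-suc i d)) (+-monoˡ-≤ d i<e)) end<n

  inner-next : ∀ {R} → GapFree R → d ∣ n ⊎ blocksEnd + d < n → (i : Fin n) →
    toℕ i < blocksEnd → R (toℕ i % d) ≡ false → R (toℕ (i ⊕ suc d) % d) ≡ true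
  inner-next {R} gf wrap i i<e missing = begin
    R (toℕ (i ⊕ suc d) % d)      ≡⟨ cong (λ t → R (t % d)) (toℕ-⊕ i (suc d)) ⟩
    R ((toℕ i + suc d) % n % d) ≡⟨ cong R (inner-residue wrap (toℕ i) i<e) ⟩
    R (suc (toℕ i) % d)          ≡⟨ gapFree-next gf d (toℕ i) missing ⟩
    true                         ∎
    where open ≡-Reasoning

  cover-isVertexCover : d ∣ n ⊎ blocksEnd + d < n → IsVertexCover n (suc d) cover
  cover-isVertexCover wrap .(u i) .(u (i ⊕ 1)) (outer i) =
    covers-edge outerRes outerRes i (i ⊕ 1) (λ _ → outer-next outerRes-gapFree i)
  cover-isVertexCover wrap .(u i) .(v i) (spoke i) =
    covers-edge outerRes innerRes i i (λ _ → outerRes-or-innerRes (toℕ i % d))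
  cover-isVertexCover wrap .(v i) .(v (i ⊕ suc d)) (inner i) =
    covers-edge innerRes innerRes i (i ⊕ suc d) (inner-next innerRes-gapFree wrap i)

  weight : ℕ → ℕ
  weight i = indicator (inPattern outerRes i) + indicator (inPattern innerRes i)

  weight-block : ∀ {i} → i < blocksEnd → weight i ≡ residueWeight (i % d)
  weight-block {i} i<e with i <? blocksEnd
  ... | yes _   = refl
  ... | no  i≮e = contradiction i<e i≮e

  weight-tail : ∀ {i} → blocksEnd ≤ i → weight i ≡ 2
  weight-tail {i} e≤i with i <? blocksEnd
  ... | yes i<e = contradiction e≤i (<⇒≱ i<e)
  ... | no  _   = refl

  size-cover : size cover ≡ sumBelow weight n
  size-cover = trans (cong₂ _+_ (∣tabulate∣ n (inPattern outerRes)) (∣tabulate∣ n (inPattern innerRes)))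
                     (sym (sumBelow-pointwise n _ _))

  sum-weight : blocksEnd ≤ n → sumBelow weight n ≡ c * suc d + (n ∸ blocksEnd) * 2
  sum-weight e≤n = begin
    sumBelow weight n
      ≡⟨ cong (sumBelow weight) (sym (m+[n∸m]≡n e≤n)) ⟩
    sumBelow weight (blocksEnd + (n ∸ blocksEnd))
      ≡⟨ sumBelow-+ blocksEnd (n ∸ blocksEnd) weight ⟩
    sumBelow weight blocksEnd + sumBelow (λ j → weight (blocksEnd + j)) (n ∸ blocksEnd)
      ≡⟨ cong₂ _+_ (sumBelow-cong blocksEnd (λ i i<e → weight-block i<e))
                   (sumBelow-cong (n ∸ blocksEnd) (λ j _ → weight-tail (m≤m+n blocksEnd j))) ⟩
    sumBelow (λ i → residueWeight (i % d)) (c * d) + sumBelow (λ _ → 2) (n ∸ blocksEnd)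
      ≡⟨ cong₂ _+_ (trans (sumBelow-periodic d c residueWeight) (cong (c *_) (period-weight d)))
                   (sumBelow-const (n ∸ blocksEnd) 2) ⟩
    c * suc d + (n ∸ blocksEnd) * 2 ∎
    where open ≡-Reasoning

  size-cover-formula : blocksEnd ≤ n → size cover ≡ n + c + (n ∸ blocksEnd)
  size-cover-formula e≤n = begin
    size cover                                   ≡⟨ size-cover ⟩
    sumBelow weight n                            ≡⟨ sum-weight e≤n ⟩
    c * suc d + (n ∸ blocksEnd) * 2              ≡⟨ cost-rearranged c d (n ∸ blocksEnd) ⟩
    blocksEnd + (n ∸ blocksEnd) + c + (n ∸ blocksEnd)
      ≡⟨ cong (λ m → m + c + (n ∸ blocksEnd)) (m+[n∸m]≡n e≤n) ⟩
    n + c + (n ∸ blocksEnd)                      ∎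
    where open ≡-Reasoning

block-cover : ∀ n d c .{{_ : NonZero n}} .{{_ : NonZero d}} →
  c * d ≤ n → d ∣ n ⊎ c * d + d < n → β≤ n (suc d) (n + c + (n ∸ c * d))
block-cover n d c cd≤n wrap = cover , cover-isVertexCover wrap , ≤-reflexive (size-cover-formula cd≤n)
  where open BlockCover n d c

β≤-weaken : ∀ {n k} .{{_ : NonZero n}} {a b} → a ≤ b → β≤ n k a → β≤ n k b
β≤-weaken a≤b (S , isCover , size≤a) = S , isCover , ≤-trans size≤a a≤b

divisible-case : ∀ n d .{{_ : NonZero n}} .{{_ : NonZero d}} →
  d ∣ n → β≤ n (suc d) (n + n / d)
divisible-case n d d∣n =
  subst (β≤ n (suc d)) no-tail (block-cover n d (n / d) (≤-reflexive q*d≡n) (inj₁ d∣n))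
  where
  q*d≡n : n / d * d ≡ n
  q*d≡n = m/n*n≡m d∣n
  no-tail : n + n / d + (n ∸ n / d * d) ≡ n + n / d
  no-tail = begin
    n + n / d + (n ∸ n / d * d) ≡⟨ cong (λ m → n + n / d + (n ∸ m)) q*d≡n ⟩
    n + n / d + (n ∸ n)         ≡⟨ cong (n + n / d +_) (n∸n≡0 n) ⟩
    n + n / d + 0               ≡⟨ +-identityʳ (n + n / d) ⟩
    n + n / d                   ∎
    where open ≡-Reasoning

-- Part (b) for n = r + q·d with 0 < r < d and q ≥ 1: use q - 1 blocks, so the
-- tail r + d is long enough for the inner edges leaving the blocks not to wrap.
remainder-case : ∀ n d q r .{{_ : NonZero n}} .{{_ : NonZero d}} →
  n ≡ r + q * d → 0 < r → r < d → 0 < q → β≤ n (suc d) (n + q + 2 * suc d)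
remainder-case n d (suc c) (suc r) n≡r+qd _ r<d _ =
  β≤-weaken bound (block-cover n d c cd≤n (inj₂ cd+d<n))
  where
  n≡tail+cd : n ≡ (suc r + d) + c * d
  n≡tail+cd = trans n≡r+qd (sym (+-assoc (suc r) d (c * d)))
  cd≤n : c * d ≤ n
  cd≤n = subst (c * d ≤_) (sym n≡tail+cd) (m≤n+m (c * d) (suc r + d))
  cd+d<n : c * d + d < n
  cd+d<n = subst₂ _<_ (+-comm d (c * d)) (sym n≡r+qd) (s<s (m≤n+m (d + c * d) r))
  tail : n ∸ c * d ≡ suc r + d
  tail = trans (cong (_∸ c * d) n≡tail+cd) (m+n∸n≡m (suc r + d) (c * d))
  tail≤2k : suc r + d ≤ 2 * suc d
  tail≤2k = +-mono-≤ (≤-trans (<⇒≤ r<d) (n≤1+n d)) (≤-trans (n≤1+n d) (m≤m+n (suc d) 0))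
  bound : n + c + (n ∸ c * d) ≤ n + suc c + 2 * suc d
  bound = subst (λ t → n + c + t ≤ n + suc c + 2 * suc d) (sym tail)
                (+-mono-≤ (+-monoʳ-≤ n (n≤1+n c)) tail≤2k)

-- Part (b): divide n by d with remainder; the remainder is positive as d ∤ n,
-- and the quotient is positive as d ≤ n.
non-divisible-case : ∀ n d .{{_ : NonZero n}} .{{_ : NonZero d}} →
  d ≤ n → d ∤ n → β≤ n (suc d) (n + n / d + 2 * suc d)
non-divisible-case n d d≤n d∤n =
  remainder-case n d (n / d) (n % d) (m≡m%n+[m/n]*n n d)
    (n≢0⇒n>0 (d∤n ∘ m%n≡0⇒n∣m n d)) (m%n<n n d) (m≥n⇒m/n>0 d≤n)

corollary12 : (n k : ℕ) (h : 2 * k < n) (hk : 2 ≤ k) → 2 ∣ k →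
    ((k ∸ 1) ∣ n → β≤ n k {{n-nonZero n k h}} (n + (n / (k ∸ 1)) {{k-1-nonZero hk}}))
    × ((k ∸ 1) ∤ n → β≤ n k {{n-nonZero n k h}} (n + (n / (k ∸ 1)) {{k-1-nonZero hk}} + 2 * k))
corollary12 n zero    h () _
corollary12 n (suc d) h hk _ = divisible-case n d , non-divisible-case n d d≤n
  where
  instance
    n≢0 : NonZero n
    n≢0 = n-nonZero n (suc d) h
    d≢0 : NonZero d
    d≢0 = k-1-nonZero hk
  d≤n : d ≤ n
  d≤n = ≤-trans (n≤1+n d) (≤-trans (m≤m+n (suc d) (suc d + 0)) (<⇒≤ h))
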